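{- Let $m\ge 1$, let $\Gamma\subseteq S_m$ be an Abelian group acting transitively on $\{1,\dots,m\}$, and let $C$ be an $m$-edge coloured cycle. Then exactly one of the following statements holds: (i) $C$ has even length and for every colour $i\in\{1,\dots,m\}$, $C$ can be switched using $\Gamma$ to be monochromatic of colour $i$; (ii) $C$ has even length and for every colour $i$, $C$ can be switched using $\Gamma$ to be nearly monochromatic of colours $(i,j)$, where $j\neq i$ depends on $i$; (iii) $C$ has odd length and for some colour $j$, $C$ can be switched using $\Gamma$ to be monochromatic of colour $j$.
   Context: An $m$-edge coloured graph is a pair $G=(G_u,\sigma)$ where $G_u$ is a finite simple graph (the underlying graph) and $\sigma$ assigns each edge a colour in $\{1,\dots,m\}$; $G$ is a cycle if $G_u$ is a cycle. For $\pi\in\Gamma$ and a vertex $v$, switching at $v$ with respect to $\pi$ produces $G^{(v,\pi)}$, in which every edge $vu$ of colour $i$ gets colour $\pi(i)$ and all other edges keep their colour. "$C$ can be switched using $\Gamma$ to be X" means some finite sequence of such switches (with permutations from $\Gamma$) transforms $C$ into an $m$-edge coloured graph with property X. A graph is monochromatic of colour $i$ if all its edges have colour $i$; a cycle is nearly monochromatic of colours $(i,j)$ if all its edges but one have colour $i$ and the remaining edge has colour $j\neq i$. -}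

module Defs where

open import Data.Nat using (ℕ; zero; suc; _≤_)
open import Data.Nat.DivMod using (_mod_)
open import Data.Nat.Divisibility using (_∣_)
open import Data.Fin using (Fin; toℕ; _≟_)
open import Data.Fin.Permutation using (Permutation′; _⟨$⟩ʳ_; _≈_; id; flip; _∘ₚ_)
open import Data.Product using (Σ; ∃; _×_; _,_)
open import Data.Sum using (_⊎_)
open import Relation.Nullary using (¬_; Dec; yes; no)
open import Relation.Nullary.Decidable using (_⊎-dec_)
open import Relation.Binary.PropositionalEquality using (_≡_; _≢_)

record AbelianTransitiveSubgroup (m : ℕ) : Set₁ where
  field
    _∈Γ     : Permutation′ m → Set
    resp    : ∀ {π ρ} → π ≈ ρ → π ∈Γ → ρ ∈Γ
    id∈     : id ∈Γ
    ∘∈      : ∀ {π ρ} → π ∈Γ → ρ ∈Γ → (π ∘ₚ ρ) ∈Γ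
    inv∈    : ∀ {π} → π ∈Γ → flip π ∈Γ
    abelian : ∀ {π ρ} → π ∈Γ → ρ ∈Γ → ∀ x → π ⟨$⟩ʳ (ρ ⟨$⟩ʳ x) ≡ ρ ⟨$⟩ʳ (π ⟨$⟩ʳ x)
    transitive : ∀ (i j : Fin m) → Σ (Permutation′ m) λ π → π ∈Γ × (π ⟨$⟩ʳ i ≡ j)

open AbelianTransitiveSubgroup public

-- The cycle C_n (n ≥ 3) on vertex set Fin n: edge e (e : Fin n) joins
-- vertex e and vertex (e + 1) mod n.  An m-edge colouring of C_n is a
-- map from edges to colours Fin m.

next : ∀ {n} → Fin n → Fin n
next {suc n} e = suc (toℕ e) mod suc n

Colouring : ℕ → ℕ → Set
Colouring n m = Fin n → Fin m

Incident : ∀ {n} → Fin n → Fin n → Set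
Incident v e = (v ≡ e) ⊎ (v ≡ next e)

incident? : ∀ {n} (v e : Fin n) → Dec (Incident v e)
incident? v e = (v ≟ e) ⊎-dec (v ≟ next e)

switch : ∀ {n m} → Fin n → Permutation′ m → Colouring n m → Colouring n m
switch v π c e with incident? v e
... | yes _ = π ⟨$⟩ʳ c e
... | no  _ = c e

data Switchable {n m} (Γ : AbelianTransitiveSubgroup m) :
                Colouring n m → Colouring n m → Set where
  done : ∀ {c} → Switchable Γ c c
  step : ∀ {c c'} (v : Fin n) (π : Permutation′ m) → (Γ ∈Γ) π →
         Switchable Γ (switch v π c) c' → Switchable Γ c c'

Monochromatic : ∀ {n m} → Colouring n m → Fin m → Set
Monochromatic c i = ∀ e → c e ≡ i

NearlyMonochromatic : ∀ {n m} → Colouring n m → Fin m → Fin m → Set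
NearlyMonochromatic c i j =
  (j ≢ i) × Σ _ λ e₀ → (c e₀ ≡ j) × (∀ e → e ≢ e₀ → c e ≡ i)

SwitchableTo : ∀ {n m} → AbelianTransitiveSubgroup m → Colouring n m →
               (Colouring n m → Set) → Set
SwitchableTo Γ c P = Σ _ λ c' → Switchable Γ c c' × P c'

Even Odd : ℕ → Set
Even n = 2 ∣ n
Odd n = ¬ (2 ∣ n)

CaseI CaseII CaseIII : ∀ {n m} → AbelianTransitiveSubgroup m → Colouring n m → Set
CaseI {n} Γ c = Even n × (∀ i → SwitchableTo Γ c (λ c' → Monochromatic c' i))
CaseII {n} Γ c = Even n ×
  (∀ i → Σ _ λ j → (j ≢ i) × SwitchableTo Γ c (λ c' → NearlyMonochromatic c' i j))
CaseIII {n} Γ c = Odd n × Σ _ λ j → SwitchableTo Γ c (λ c' → Monochromatic c' j)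

ExactlyOne : Set → Set → Set → Set
ExactlyOne A B C = (A ⊎ B ⊎ C) × ¬ (A × B) × ¬ (A × C) × ¬ (B × C)

-- Because Γ is abelian, a sequence of switches acts on an edge e = uv only through
-- the product of the permutations used at u and at v; hence the colourings reachable
-- from c are exactly those of the form e ↦ g(u) g(v) c(e) for a labelling g of the
-- vertices by elements of Γ.  Walking along the path formed by all edges but the last
-- one, g can be chosen to give these edges a fixed colour o.  Labelling the vertices
-- alternately by id and π then applies π to every edge, except to the closing edge when
-- the cycle is odd; this produces the colourings of (i)–(iii).  Finally, an abelian
-- transitive group acts regularly, so on an even cycle a labelling that preserves a
-- monochromatic colouring on all edges but one alternates between two mutually inverse
-- elements and therefore preserves it on the remaining edge too: (i) and (ii) exclude
-- each other.

module Submission where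

open import Defs
open import Data.Nat using (ℕ; zero; suc; _+_; _*_; _∸_; _≤_; _<_; z≤n; s≤s; s≤s⁻¹; _%_; _<?_; NonZero)
open import Data.Nat.Properties
  using (+-comm; +-suc; +-cancelˡ-≡; +-identityʳ; +-mono-<; <-irrefl; ≮⇒≥; <⇒≤; ≤-refl; n<1+n; m<n⇒m<1+n;
         m≤n⇒m<n∨m≡n; m<n+o⇒m∸n<o; m∸n+n≡m)
open import Data.Nat.DivMod
  using (_mod_; %-distribˡ-+; m%n%n≡m%n; [m+n]%n≡m%n; m<n⇒m%n≡m; m≤n⇒[n∸m]%m≡n%m; n%n≡0)
open import Data.Nat.Divisibility using (divides; _∣?_)
open import Data.Fin using (Fin; zero; toℕ; fromℕ; fromℕ<; inject₁; _≟_)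
open import Data.Fin.Properties using (toℕ-injective; toℕ-fromℕ<; toℕ-fromℕ; inject₁ℕ<; toℕ<n)
open import Data.Fin.Relation.Unary.Top using (view; ‵fromℕ; ‵inject₁)
open import Data.Fin.Permutation
  using (Permutation′; _⟨$⟩ʳ_; _≈_; id; flip; _∘ₚ_; inverseˡ; inverseʳ)
open import Data.Product using (Σ; _×_; _,_; proj₁; proj₂)
open import Data.Sum using (_⊎_; inj₁; inj₂; [_,_]′)
open import Function using (_∘_; Injection)
open import Function.Properties.Inverse using (↔⇒↣)
open import Relation.Nullary using (¬_; Dec; yes; no; contradiction)
open import Relation.Binary.PropositionalEquality

private
  variable
    m n : ℕ

⟨$⟩ʳ-injective : (π : Permutation′ m) {x y : Fin m} → π ⟨$⟩ʳ x ≡ π ⟨$⟩ʳ y → x ≡ y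
⟨$⟩ʳ-injective π = Injection.injective (↔⇒↣ π)

alternating : Permutation′ m → ℕ → Permutation′ m
alternating π zero          = id
alternating π (suc zero)    = π
alternating π (suc (suc k)) = alternating π k

alternating-adjacent : ∀ (π : Permutation′ m) k x →
                       alternating π k ⟨$⟩ʳ (alternating π (suc k) ⟨$⟩ʳ x) ≡ π ⟨$⟩ʳ x
alternating-adjacent π zero          x = refl
alternating-adjacent π (suc zero)    x = refl
alternating-adjacent π (suc (suc k)) x = alternating-adjacent π k x

alternating-odd : ∀ (π : Permutation′ m) q → alternating π (suc (q * 2)) ≡ π
alternating-odd π zero    = refl
alternating-odd π (suc q) = alternating-odd π q

alternating-pred-even : ∀ (π : Permutation′ m) k → Even (suc k) → alternating π k ≡ π
alternating-pred-even π _ (divides zero    ())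
alternating-pred-even π _ (divides (suc q) refl) = alternating-odd π q

alternating-pred-odd : ∀ (π : Permutation′ m) k → Odd (suc k) → alternating π k ≡ id
alternating-pred-odd π zero          _   = refl
alternating-pred-odd π (suc zero)    odd = contradiction (divides 1 refl) odd
alternating-pred-odd π (suc (suc k)) odd =
  alternating-pred-odd π k λ { (divides q eq) → odd (divides (suc q) (cong (2 +_) eq)) }

[m+k]%n≢m : ∀ {m k n} .{{_ : NonZero n}} → m < n → 0 < k → k < n → (m + k) % n ≢ m
[m+k]%n≢m {m} {k} {n} m<n 0<k k<n eq with m + k <? n
... | yes m+k<n = <-irrefl (sym k≡0) 0<k
  where
  k≡0 : k ≡ 0
  k≡0 = +-cancelˡ-≡ m k 0 (trans (trans (sym (m<n⇒m%n≡m m+k<n)) eq) (sym (+-identityʳ m)))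
... | no m+k≮n = <-irrefl k≡n k<n
  where
  n≤m+k : n ≤ m + k
  n≤m+k = ≮⇒≥ m+k≮n
  m+k∸n≡m : m + k ∸ n ≡ m
  m+k∸n≡m = begin
    m + k ∸ n        ≡⟨ m<n⇒m%n≡m (m<n+o⇒m∸n<o (m + k) n (+-mono-< m<n k<n)) ⟨
    (m + k ∸ n) % n  ≡⟨ m≤n⇒[n∸m]%m≡n%m n≤m+k ⟩
    (m + k) % n      ≡⟨ eq ⟩
    m                ∎
    where open ≡-Reasoning
  k≡n : k ≡ n
  k≡n = +-cancelˡ-≡ m k n (trans (sym (m∸n+n≡m n≤m+k)) (cong (_+ n) m+k∸n≡m))

_⊕_ : Fin (suc n) → ℕ → Fin (suc n)
_⊕_ {n} e k = (toℕ e + k) mod suc n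

next≡⊕1 : (e : Fin (suc n)) → next e ≡ e ⊕ 1
next≡⊕1 {n} e = cong (_mod suc n) (+-comm 1 (toℕ e))

next-⊕ : ∀ (e : Fin (suc n)) k → next (e ⊕ k) ≡ e ⊕ suc k
next-⊕ {n} e k = toℕ-injective (begin
  toℕ (next (e ⊕ k))                   ≡⟨ toℕ-fromℕ< _ ⟩
  suc (toℕ (e ⊕ k)) % N                ≡⟨ cong (λ t → suc t % N) (toℕ-fromℕ< _) ⟩
  suc ((toℕ e + k) % N) % N            ≡⟨ %-distribˡ-+ 1 ((toℕ e + k) % N) N ⟩
  (1 % N + (toℕ e + k) % N % N) % N    ≡⟨ cong (λ t → (1 % N + t) % N) (m%n%n≡m%n (toℕ e + k) N) ⟩
  (1 % N + (toℕ e + k) % N) % N        ≡⟨ %-distribˡ-+ 1 (toℕ e + k) N ⟨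
  suc (toℕ e + k) % N                  ≡⟨ cong (_% N) (+-suc (toℕ e) k) ⟨
  (toℕ e + suc k) % N                  ≡⟨ toℕ-fromℕ< _ ⟨
  toℕ (e ⊕ suc k)                      ∎)
  where
  N = suc n
  open ≡-Reasoning

⊕-length : (e : Fin (suc n)) → e ⊕ suc n ≡ e
⊕-length {n} e = toℕ-injective (begin
  toℕ (e ⊕ suc n)          ≡⟨ toℕ-fromℕ< _ ⟩
  (toℕ e + suc n) % suc n  ≡⟨ [m+n]%n≡m%n (toℕ e) (suc n) ⟩
  toℕ e % suc n            ≡⟨ m<n⇒m%n≡m (toℕ<n e) ⟩
  toℕ e                    ∎)
  where open ≡-Reasoning

⊕-≢ : ∀ (e : Fin (suc n)) {k} → 0 < k → k < suc n → e ⊕ k ≢ e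
⊕-≢ e 0<k k<N eq = [m+k]%n≢m (toℕ<n e) 0<k k<N (trans (sym (toℕ-fromℕ< _)) (cong toℕ eq))

next≢ : 1 ≤ n → (e : Fin (suc n)) → next e ≢ e
next≢ 1≤n e eq = ⊕-≢ e (s≤s z≤n) (s≤s 1≤n) (trans (sym (next≡⊕1 e)) eq)

toℕ-next-inject₁ : (j : Fin n) → toℕ (next (inject₁ j)) ≡ suc (toℕ (inject₁ j))
toℕ-next-inject₁ j = trans (toℕ-fromℕ< _) (m<n⇒m%n≡m (s≤s (inject₁ℕ< j)))

toℕ-next-fromℕ : ∀ n → toℕ (next (fromℕ n)) ≡ 0
toℕ-next-fromℕ n = trans (toℕ-fromℕ< _)
  (trans (cong (λ t → suc t % suc n) (toℕ-fromℕ n)) (n%n≡0 (suc n)))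

mod-toℕ : (e : Fin (suc n)) → toℕ e mod suc n ≡ e
mod-toℕ e = toℕ-injective (trans (toℕ-fromℕ< _) (m<n⇒m%n≡m (toℕ<n e)))

inject₁-or-fromℕ : ∀ {P : Fin (suc n) → Set} → (∀ j → P (inject₁ j)) → P (fromℕ n) → ∀ e → P e
inject₁-or-fromℕ inner last e with view e
... | ‵fromℕ     = last
... | ‵inject₁ j = inner j

Labelling : ℕ → ℕ → Set
Labelling n m = Fin n → Permutation′ m

-- The colouring obtained by switching every vertex v with respect to g v.
relabel : Labelling (suc n) m → Colouring (suc n) m → Colouring (suc n) m
relabel g c e = g e ⟨$⟩ʳ (g (next e) ⟨$⟩ʳ c e)

relabel-congˡ : ∀ (g h : Labelling (suc n) m) → (∀ v → g v ≈ h v) → ∀ c e → relabel g c e ≡ relabel h c e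
relabel-congˡ g h g≈h c e = trans (cong (g e ⟨$⟩ʳ_) (g≈h (next e) _)) (g≈h e _)

relabel-congʳ : ∀ (g : Labelling (suc n) m) {c d} → (∀ e → c e ≡ d e) → ∀ e → relabel g c e ≡ relabel g d e
relabel-congʳ g c≗d e = cong (λ x → g e ⟨$⟩ʳ (g (next e) ⟨$⟩ʳ x)) (c≗d e)

-- _∘ₚ_ is diagrammatic, so (g ⊙ h) v applies h v first.
_⊙_ : Labelling n m → Labelling n m → Labelling n m
(g ⊙ h) v = h v ∘ₚ g v

single : Fin n → Permutation′ m → Labelling n m
single v π w with v ≟ w
... | yes _ = π
... | no  _ = id

switch≗relabel-single : 1 ≤ n → ∀ v (π : Permutation′ m) (c : Colouring (suc n) m) e →
                        switch v π c e ≡ relabel (single v π) c e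
switch≗relabel-single 1≤n v π c e with v ≟ e | v ≟ next e
... | yes refl | yes v≡next = contradiction (sym v≡next) (next≢ 1≤n v)
... | yes _    | no  _      = refl
... | no  _    | yes _      = refl
... | no  _    | no  _      = refl

below : ℕ → Labelling n m → Labelling n m
below k g w with toℕ w <? k
... | yes _ = g w
... | no  _ = id

below-zero : ∀ (g : Labelling n m) w → below 0 g w ≈ id
below-zero g w x with toℕ w <? 0
... | no _ = refl

below-all : ∀ (g : Labelling n m) w → below n g w ≈ g w
below-all {n} g w x with toℕ w <? n
... | yes _   = refl
... | no  w≮n = contradiction (toℕ<n w) w≮n

single⊙below : ∀ (g : Labelling n m) {k} (v : Fin n) → toℕ v ≡ k →
               ∀ w → (single v (g v) ⊙ below k g) w ≈ below (suc k) g w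
single⊙below g v refl w x with v ≟ w | toℕ w <? toℕ v | toℕ w <? suc (toℕ v)
... | yes refl | yes w<w   | _         = contradiction w<w (<-irrefl refl)
... | yes refl | no  _     | yes _     = refl
... | yes refl | no  _     | no  w≮1+w = contradiction (n<1+n (toℕ w)) w≮1+w
... | no  _    | yes _     | yes _     = refl
... | no  _    | yes w<v   | no  w≮1+v = contradiction (m<n⇒m<1+n w<v) w≮1+v
... | no  _    | no  _     | no  _     = refl
... | no  v≢w  | no  w≮v   | yes w<1+v with m≤n⇒m<n∨m≡n (s≤s⁻¹ w<1+v)
...   | inj₁ w<v = contradiction w<v w≮v
...   | inj₂ w≡v = contradiction (sym (toℕ-injective w≡v)) v≢w

Switchable-trans : ∀ {Γ : AbelianTransitiveSubgroup m} {c d f : Colouring n m} →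
                   Switchable Γ c d → Switchable Γ d f → Switchable Γ c f
Switchable-trans done            t = t
Switchable-trans (step v π π∈ s) t = step v π π∈ (Switchable-trans s t)

module _ (Γ : AbelianTransitiveSubgroup m) where

  fixes⇒≈id : ∀ {π} → (Γ ∈Γ) π → ∀ {i} → π ⟨$⟩ʳ i ≡ i → π ≈ id
  fixes⇒≈id {π} π∈ {i} πi≡i x =
    let (τ , τ∈ , τi≡x) = transitive Γ i x
        open ≡-Reasoning
    in begin
      π ⟨$⟩ʳ x            ≡⟨ cong (π ⟨$⟩ʳ_) τi≡x ⟨
      π ⟨$⟩ʳ (τ ⟨$⟩ʳ i)   ≡⟨ abelian Γ π∈ τ∈ i ⟩
      τ ⟨$⟩ʳ (π ⟨$⟩ʳ i)   ≡⟨ cong (τ ⟨$⟩ʳ_) πi≡i ⟩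
      τ ⟨$⟩ʳ i            ≡⟨ τi≡x ⟩
      x                   ∎

  consecutive-inverses⇒period-two :
    (x : ℕ → Permutation′ m) → (∀ k → (Γ ∈Γ) (x k)) → ∀ q →
    (∀ k → k < q * 2 → ∀ a → x k ⟨$⟩ʳ (x (suc k) ⟨$⟩ʳ a) ≡ a) → x (q * 2) ≈ x 0
  consecutive-inverses⇒period-two x x∈ zero    inverse a = refl
  consecutive-inverses⇒period-two x x∈ (suc q) inverse a = ⟨$⟩ʳ-injective (x (suc k)) (begin
    x (suc k) ⟨$⟩ʳ (x (suc (suc k)) ⟨$⟩ʳ a)  ≡⟨ inverse (suc k) (n<1+n (suc k)) a ⟩
    a                                       ≡⟨ inverse k (m<n⇒m<1+n (n<1+n k)) a ⟨
    x k ⟨$⟩ʳ (x (suc k) ⟨$⟩ʳ a)              ≡⟨ abelian Γ (x∈ k) (x∈ (suc k)) a ⟩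
    x (suc k) ⟨$⟩ʳ (x k ⟨$⟩ʳ a)              ≡⟨ cong (x (suc k) ⟨$⟩ʳ_) (consecutive-inverses⇒period-two x x∈ q
                                                 (λ j j<k → inverse j (m<n⇒m<1+n (m<n⇒m<1+n j<k))) a) ⟩
    x (suc k) ⟨$⟩ʳ (x 0 ⟨$⟩ʳ a)              ∎)
    where
    k = q * 2
    open ≡-Reasoning

  InΓ : Labelling n m → Set
  InΓ g = ∀ v → (Γ ∈Γ) (g v)

  single∈ : ∀ {π} (v : Fin n) → (Γ ∈Γ) π → InΓ (single v π)
  single∈ v π∈ w with v ≟ w
  ... | yes _ = π∈
  ... | no  _ = id∈ Γ

  below∈ : ∀ {g : Labelling n m} k → InΓ g → InΓ (below k g)
  below∈ k g∈ w with toℕ w <? k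
  ... | yes _ = g∈ w
  ... | no  _ = id∈ Γ

  relabel-⊙ : ∀ {g h : Labelling (suc n) m} → InΓ g → InΓ h → ∀ c e →
              relabel g (relabel h c) e ≡ relabel (g ⊙ h) c e
  relabel-⊙ {g = g} g∈ h∈ c e = cong (g e ⟨$⟩ʳ_) (abelian Γ (g∈ (next e)) (h∈ e) _)

  infix 4 _∼_
  _∼_ : Colouring (suc n) m → Colouring (suc n) m → Set
  c ∼ d = Σ (Labelling _ _) λ g → InΓ g × (∀ e → d e ≡ relabel g c e)

  ∼-refl : {c : Colouring (suc n) m} → c ∼ c
  ∼-refl = (λ _ → id) , (λ _ → id∈ Γ) , (λ _ → refl)

  ∼-trans : {c d f : Colouring (suc n) m} → c ∼ d → d ∼ f → c ∼ f
  ∼-trans {c = c} (g , g∈ , d≗) (h , h∈ , f≗) =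
    h ⊙ g , (λ v → ∘∈ Γ (g∈ v) (h∈ v)) ,
    λ e → trans (f≗ e) (trans (relabel-congʳ h d≗ e) (relabel-⊙ h∈ g∈ c e))

  ∼-sym : {c d : Colouring (suc n) m} → c ∼ d → d ∼ c
  ∼-sym {c = c} {d} (g , g∈ , d≗) = g⁻¹ , g⁻¹∈ , λ e → sym (begin
    relabel g⁻¹ d e                ≡⟨ relabel-congʳ g⁻¹ d≗ e ⟩
    relabel g⁻¹ (relabel g c) e    ≡⟨ relabel-⊙ g⁻¹∈ g∈ c e ⟩
    relabel (g⁻¹ ⊙ g) c e          ≡⟨ relabel-congˡ (g⁻¹ ⊙ g) (λ _ → id) (λ v _ → inverseˡ (g v)) c e ⟩
    c e                            ∎)
    where
    g⁻¹ = flip ∘ g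
    g⁻¹∈ : InΓ g⁻¹
    g⁻¹∈ = inv∈ Γ ∘ g∈
    open ≡-Reasoning

  Switchable⇒∼ : 1 ≤ n → {c d : Colouring (suc n) m} → Switchable Γ c d → c ∼ d
  Switchable⇒∼ 1≤n done              = ∼-refl
  Switchable⇒∼ 1≤n (step v π π∈ s) =
    ∼-trans (single v π , single∈ v π∈ , switch≗relabel-single 1≤n v π _) (Switchable⇒∼ 1≤n s)

  relabel-switchable : 1 ≤ n → {g : Labelling (suc n) m} → InΓ g → (c : Colouring (suc n) m) →
                       SwitchableTo Γ c (λ d → ∀ e → d e ≡ relabel g c e)
  relabel-switchable {n} 1≤n {g} g∈ c =
    let (d , s , d≗) = sweep (suc n) ≤-refl
    in d , s , λ e → trans (d≗ e) (relabel-congˡ (below (suc n) g) g (below-all g) c e)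
    where
    sweep : ∀ k → k ≤ suc n → SwitchableTo Γ c (λ d → ∀ e → d e ≡ relabel (below k g) c e)
    sweep zero    _   = c , done , λ e → sym (relabel-congˡ (below 0 g) (λ _ → id) (below-zero g) c e)
    sweep (suc k) k<N =
      let (d , s , d≗) = sweep k (<⇒≤ k<N)
          v = fromℕ< k<N
          open ≡-Reasoning
      in switch v (g v) d , Switchable-trans s (step v (g v) (g∈ v) done) , λ e → begin
        switch v (g v) d e                                  ≡⟨ switch≗relabel-single 1≤n v (g v) d e ⟩
        relabel (single v (g v)) d e                        ≡⟨ relabel-congʳ (single v (g v)) d≗ e ⟩
        relabel (single v (g v)) (relabel (below k g) c) e  ≡⟨ relabel-⊙ (single∈ v (g∈ v)) (below∈ k g∈) c e ⟩
        relabel (single v (g v) ⊙ below k g) c e            ≡⟨ relabel-congˡ (single v (g v) ⊙ below k g) (below (suc k) g)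
                                                                 (single⊙below g v (toℕ-fromℕ< k<N)) c e ⟩
        relabel (below (suc k) g) c e                       ∎

  pathLabel : Colouring (suc n) m → Fin m → ℕ → Permutation′ m
  pathLabel         c o zero    = id
  pathLabel {n = n} c o (suc k) = proj₁ (transitive Γ (c (k mod suc n)) (flip (pathLabel c o k) ⟨$⟩ʳ o))

  pathLabel∈ : ∀ (c : Colouring (suc n) m) o k → (Γ ∈Γ) (pathLabel c o k)
  pathLabel∈ c o zero    = id∈ Γ
  pathLabel∈ c o (suc k) = proj₁ (proj₂ (transitive Γ _ _))

  pathLabel-step : ∀ (c : Colouring (suc n) m) o k →
                   pathLabel c o k ⟨$⟩ʳ (pathLabel c o (suc k) ⟨$⟩ʳ c (k mod suc n)) ≡ o
  pathLabel-step c o k =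
    trans (cong (pathLabel c o k ⟨$⟩ʳ_) (proj₂ (proj₂ (transitive Γ _ _)))) (inverseʳ (pathLabel c o k))

  straighten-path : 1 ≤ n → (o : Fin m) (c : Colouring (suc n) m) →
               SwitchableTo Γ c (λ d → ∀ j → d (inject₁ j) ≡ o)
  straighten-path 1≤n o c =
    let (d , s , d≗) = relabel-switchable 1≤n (pathLabel∈ c o ∘ toℕ) c
    in d , s , λ j → trans (d≗ (inject₁ j)) (relabel-path j)
    where
    P = pathLabel c o
    relabel-path : ∀ j → relabel (P ∘ toℕ) c (inject₁ j) ≡ o
    relabel-path j = begin
      P k ⟨$⟩ʳ (P (toℕ (next e)) ⟨$⟩ʳ c e)  ≡⟨ cong (λ t → P k ⟨$⟩ʳ (P t ⟨$⟩ʳ c e)) (toℕ-next-inject₁ j) ⟩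
      P k ⟨$⟩ʳ (P (suc k) ⟨$⟩ʳ c e)         ≡⟨ cong (λ e′ → P k ⟨$⟩ʳ (P (suc k) ⟨$⟩ʳ c e′)) (mod-toℕ e) ⟨
      P k ⟨$⟩ʳ (P (suc k) ⟨$⟩ʳ c (k mod _)) ≡⟨ pathLabel-step c o k ⟩
      o                                     ∎
      where
      e = inject₁ j
      k = toℕ e
      open ≡-Reasoning

  alternating∈ : ∀ {π} → (Γ ∈Γ) π → ∀ k → (Γ ∈Γ) (alternating π k)
  alternating∈ π∈ zero          = id∈ Γ
  alternating∈ π∈ (suc zero)    = π∈
  alternating∈ π∈ (suc (suc k)) = alternating∈ π∈ k

  alternating-switchable : 1 ≤ n → ∀ {π} → (Γ ∈Γ) π → (d : Colouring (suc n) m) →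
              SwitchableTo Γ d (λ d′ → (∀ j → d′ (inject₁ j) ≡ π ⟨$⟩ʳ d (inject₁ j)) ×
                                       d′ (fromℕ n) ≡ alternating π n ⟨$⟩ʳ d (fromℕ n))
  alternating-switchable {n} 1≤n {π} π∈ d =
    let (d′ , s , d′≗) = relabel-switchable 1≤n (alternating∈ π∈ ∘ toℕ) d
    in d′ , s , (λ j → trans (d′≗ (inject₁ j)) (inner j)) , trans (d′≗ (fromℕ n)) closing
    where
    A = alternating π
    inner : ∀ j → relabel (A ∘ toℕ) d (inject₁ j) ≡ π ⟨$⟩ʳ d (inject₁ j)
    inner j = trans (cong (λ t → A (toℕ (inject₁ j)) ⟨$⟩ʳ (A t ⟨$⟩ʳ d (inject₁ j))) (toℕ-next-inject₁ j))
                    (alternating-adjacent π (toℕ (inject₁ j)) (d (inject₁ j)))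
    closing : relabel (A ∘ toℕ) d (fromℕ n) ≡ A n ⟨$⟩ʳ d (fromℕ n)
    closing = cong₂ (λ s t → A s ⟨$⟩ʳ (A t ⟨$⟩ʳ d (fromℕ n))) (toℕ-fromℕ n) (toℕ-next-fromℕ n)

  even⇒postcompose-switchable : 1 ≤ n → Even (suc n) → (d : Colouring (suc n) m) → ∀ {π} → (Γ ∈Γ) π →
                  SwitchableTo Γ d (λ d′ → ∀ e → d′ e ≡ π ⟨$⟩ʳ d e)
  even⇒postcompose-switchable {n} 1≤n even d {π} π∈ =
    let (d′ , s , inner , last) = alternating-switchable 1≤n π∈ d
    in d′ , s , inject₁-or-fromℕ inner
                  (trans last (cong (_⟨$⟩ʳ d (fromℕ n)) (alternating-pred-even π n even)))

  even⇒const-off-edge⇒const : Even (suc n) → ∀ {h : Labelling (suc n) m} → InΓ h → ∀ i e₀ →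
                (∀ e → e ≢ e₀ → relabel h (λ _ → i) e ≡ i) → relabel h (λ _ → i) e₀ ≡ i
  even⇒const-off-edge⇒const (divides zero ())
  even⇒const-off-edge⇒const (divides (suc q) refl) {h} h∈ i e₀ off-e₀ = begin
    h e₀ ⟨$⟩ʳ (h (next e₀) ⟨$⟩ʳ i)           ≡⟨ abelian Γ (h∈ e₀) (h∈ (next e₀)) i ⟩
    h (next e₀) ⟨$⟩ʳ (h e₀ ⟨$⟩ʳ i)           ≡⟨ cong₂ (λ u w → h u ⟨$⟩ʳ (h w ⟨$⟩ʳ i))
                                                  (next≡⊕1 e₀) (sym (⊕-length e₀)) ⟩
    x 0 ⟨$⟩ʳ (x (suc (q * 2)) ⟨$⟩ʳ i)        ≡⟨ consecutive-inverses⇒period-two x (h∈ ∘ (e₀ ⊕_) ∘ suc) q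
                                                  (λ k k<2q → inverse k (m<n⇒m<1+n k<2q)) _ ⟨
    x (q * 2) ⟨$⟩ʳ (x (suc (q * 2)) ⟨$⟩ʳ i)  ≡⟨ inverse (q * 2) (n<1+n (q * 2)) i ⟩
    i                                       ∎
    where
    open ≡-Reasoning
    x : ℕ → Permutation′ _
    x k = h (e₀ ⊕ suc k)
    inverse : ∀ k → k < suc (q * 2) → ∀ a → x k ⟨$⟩ʳ (x (suc k) ⟨$⟩ʳ a) ≡ a
    inverse k k<n = fixes⇒≈id (∘∈ Γ (h∈ _) (h∈ _))
      (trans (cong (λ u → x k ⟨$⟩ʳ (h u ⟨$⟩ʳ i)) (sym (next-⊕ e₀ (suc k))))
             (off-e₀ (e₀ ⊕ suc k) (⊕-≢ e₀ (s≤s z≤n) (s≤s k<n))))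

  even⇒¬monochromatic×nearlyMonochromatic :
    1 ≤ n → Even (suc n) → {c c₁ c₂ : Colouring (suc n) m} → ∀ {i j} →
    Switchable Γ c c₁ → Switchable Γ c c₂ → Monochromatic c₁ i → ¬ NearlyMonochromatic c₂ i j
  even⇒¬monochromatic×nearlyMonochromatic 1≤n even {i = i} s₁ s₂ mono (j≢i , e₀ , c₂e₀≡j , off-e₀) =
    let (h , h∈ , c₂≗) = ∼-trans (∼-sym (Switchable⇒∼ 1≤n s₁)) (Switchable⇒∼ 1≤n s₂)
        c₂≗h·i : ∀ e → _
        c₂≗h·i e = trans (c₂≗ e) (relabel-congʳ h mono e)
    in j≢i (trans (sym c₂e₀≡j) (trans (c₂≗h·i e₀)
             (even⇒const-off-edge⇒const even h∈ i e₀ (λ e e≢e₀ → trans (sym (c₂≗h·i e)) (off-e₀ e e≢e₀)))))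

  odd⇒CaseIII : 1 ≤ n → Odd (suc n) → Fin m → (c : Colouring (suc n) m) → CaseIII Γ c
  odd⇒CaseIII {n} 1≤n odd o c =
    let (d , s₁ , d-inner) = straighten-path 1≤n o c
        z = d (fromℕ n)
        (π , π∈ , πo≡z) = transitive Γ o z
        (c′ , s₂ , c′-inner , c′-last) = alternating-switchable 1≤n π∈ d
    in odd , z , c′ , Switchable-trans s₁ s₂ ,
       inject₁-or-fromℕ (λ j → trans (c′-inner j) (trans (cong (π ⟨$⟩ʳ_) (d-inner j)) πo≡z))
                        (trans c′-last (cong (_⟨$⟩ʳ z) (alternating-pred-odd π n odd)))

  even⇒CaseI⊎CaseII : 1 ≤ n → Even (suc n) → Fin m → (c : Colouring (suc n) m) → CaseI Γ c ⊎ CaseII Γ c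
  even⇒CaseI⊎CaseII {n} 1≤n even o c with straighten-path 1≤n o c
  ... | d , s₁ , d-inner = classify (z ≟ o)
    where
    z = d (fromℕ n)
    recoloured : ∀ {π} → (Γ ∈Γ) π → SwitchableTo Γ c (λ c′ → ∀ e → c′ e ≡ π ⟨$⟩ʳ d e)
    recoloured π∈ = let (c′ , s₂ , c′≗) = even⇒postcompose-switchable 1≤n even d π∈ in c′ , Switchable-trans s₁ s₂ , c′≗
    classify : Dec (z ≡ o) → CaseI Γ c ⊎ CaseII Γ c
    classify (yes z≡o) = inj₁ (even , λ i →
      let (π , π∈ , πo≡i) = transitive Γ o i
          (c′ , s , c′≗) = recoloured π∈
      in c′ , s , λ e → trans (c′≗ e) (trans (cong (π ⟨$⟩ʳ_) (inject₁-or-fromℕ d-inner z≡o e)) πo≡i))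
    classify (no z≢o) = inj₂ (even , λ i →
      let (π , π∈ , πo≡i) = transitive Γ o i
          (c′ , s , c′≗) = recoloured π∈
          πz≢i : π ⟨$⟩ʳ z ≢ i
          πz≢i πz≡i = z≢o (⟨$⟩ʳ-injective π (trans πz≡i (sym πo≡i)))
      in π ⟨$⟩ʳ z , πz≢i , c′ , s , πz≢i , fromℕ n , c′≗ (fromℕ n) ,
         inject₁-or-fromℕ (λ j _ → trans (c′≗ (inject₁ j)) (trans (cong (π ⟨$⟩ʳ_) (d-inner j)) πo≡i))
                          (λ last≢last → contradiction refl last≢last))

proposition2p1 : (m : ℕ) → 1 ≤ m → (Γ : AbelianTransitiveSubgroup m) →
    (n : ℕ) → 3 ≤ n → (c : Colouring n m) →
    ExactlyOne (CaseI Γ c) (CaseII Γ c) (CaseIII Γ c)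
proposition2p1 (suc m) _ Γ (suc n) (s≤s 2≤n) c =
  cases (2 ∣? suc n) ,
  (λ ((even , to-monochromatic) , (_ , to-nearly)) →
     let (c₁ , s₁ , mono) = to-monochromatic zero
         (_ , _ , c₂ , s₂ , nearly) = to-nearly zero
     in even⇒¬monochromatic×nearlyMonochromatic Γ 1≤n even s₁ s₂ mono nearly) ,
  (λ ((even , _) , (odd , _)) → odd even) ,
  (λ ((even , _) , (odd , _)) → odd even)
  where
  1≤n : 1 ≤ n
  1≤n = <⇒≤ 2≤n
  cases : Dec (Even (suc n)) → CaseI Γ c ⊎ CaseII Γ c ⊎ CaseIII Γ c
  cases (yes even) = [ inj₁ , inj₂ ∘ inj₁ ]′ (even⇒CaseI⊎CaseII Γ 1≤n even zero c)
  cases (no odd)   = inj₂ (inj₂ (odd⇒CaseIII Γ 1≤n odd zero c))
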